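{- Let $T$ be the free model monad of an algebraic theory with an idempotent binary operation $\diamond$ (i.e. $\diamond(x,x)=x$ holds), and let $\zeta:TD\to DT$ be a distributive law. For each $T$-model $X$, equip $DX$ with the $T$-model structure induced by $\zeta$. Then there exist binary $T$-operations $\diamond_1$ and $\diamond'$ (i.e. terms in two variables, modulo the equations of the theory, interpreted in every $T$-model) such that for every $T$-model $X$ and all $x,y:DX$, $$\diamond(\mathsf{step}\,x,\mathsf{step}\,y)=\mathsf{step}(\diamond_1(x,y)),$$ and either $$\diamond(\mathsf{step}\,x,y)=\mathsf{step}(\diamond'(x,y))\ \text{ and }\ \diamond'(x,\mathsf{step}\,y)=\diamond_1(x,y)$$ for all $x,y$, or $$\diamond(\mathsf{step}\,x,y)=\diamond'(x,y)\ \text{ and }\ \diamond'(x,\mathsf{step}\,y)=\mathsf{step}(\diamond_1(x,y))$$ for all $x,y$. Furthermore, $\diamond_1$ is idempotent, and it is associative (respectively commutative) whenever $\diamond$ is associative (respectively commutative).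
   Context: $D$ is the coinductive delay monad: $DX$ is the final coalgebra $DX\simeq X+DX$, with $\mathsf{now}:X\to DX$, $\mathsf{step}:DX\to DX$ (in the paper, working in Clocked Cubical Type Theory, $DX=\forall\kappa.D^\kappa X$ with $D^\kappa X\simeq X+\triangleright^\kappa D^\kappa X$). A distributive law $\zeta:TD\to DT$ is a natural transformation satisfying the unit axioms $\zeta\circ\eta^T D=D\eta^T$, $\zeta\circ T\eta^D=\eta^D T$ and the multiplication axioms $\zeta\circ\mu^T D=D\mu^T\circ\zeta T\circ T\zeta$, $\zeta\circ T\mu^D=\mu^D T\circ D\zeta\circ\zeta D$; equivalently it is a lifting of $D$ to the category of $T$-algebras, so that each $T$-model structure on $X$ induces one on $DX$, with $\mathsf{now}$ and $\mu^D$ homomorphisms. -}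

module Defs where

open import Level using (0ℓ)
open import Data.Nat using (ℕ; zero; suc)
open import Data.Fin using (Fin; zero; suc)
open import Data.Maybe using (Maybe; just; nothing)
import Data.Maybe as Maybe
open import Data.Maybe.Relation.Binary.Pointwise using (Pointwise; just; nothing)
import Data.Maybe.Relation.Binary.Pointwise as PW
open import Relation.Binary.Bundles using (Setoid)
open import Relation.Binary.PropositionalEquality using (_≡_)
open import Function.Bundles using (Func)

-- The delay monad  D X ≃ X + D X.
--
-- Equality of delayed values is strong bisimilarity, i.e. equality of the
-- canonical observation  run d  (see Bisim below).

Delay : Set → Set
Delay X = ℕ → Maybe X

now : {X : Set} → X → Delay X
now x _ = just x

step : {X : Set} → Delay X → Delay X
step d zero    = nothing
step d (suc n) = d n

-- canonical observation: run d n = just x  iff  d terminates with x after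
-- exactly n steps
run : {X : Set} → Delay X → ℕ → Maybe X
run d zero    = d zero
run d (suc n) with d zero
... | just _  = nothing
... | nothing = run (λ k → d (suc k)) n

Dmap : {X Y : Set} → (X → Y) → Delay X → Delay Y
Dmap f d n = Maybe.map f (d n)

-- multiplication μ^D :  μ (now d) = d ,  μ (step s) = step (μ s)
Djoin : {X : Set} → Delay (Delay X) → Delay X
Djoin s n with s zero
Djoin s n       | just d  = d n
Djoin s zero    | nothing = nothing
Djoin s (suc n) | nothing = Djoin (λ k → s (suc k)) n

Bisim : {X Y : Set} (R : X → Y → Set) → Delay X → Delay Y → Set
Bisim R d e = ∀ n → Pointwise R (run d n) (run e n)

DS : Setoid 0ℓ 0ℓ → Setoid 0ℓ 0ℓ
DS S = record
  { Carrier = Delay Carrier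
  ; _≈_ = Bisim _≈_
  ; isEquivalence = record
    { refl  = λ {d} n → PW.refl refl
    ; sym   = λ p n → PW.sym sym (p n)
    ; trans = λ p q n → PW.trans trans (p n) (q n)
    }
  }
  where open Setoid S

data Term (Op : ℕ → Set) (X : Set) : Set where
  var : X → Term Op X
  op  : ∀ {n} → Op n → (Fin n → Term Op X) → Term Op X

record Theory : Set₁ where
  field
    Op  : ℕ → Set
    Ax  : ℕ → Set
    lhs : ∀ {n} → Ax n → Term Op (Fin n)
    rhs : ∀ {n} → Ax n → Term Op (Fin n)

pair : {A : Set} → A → A → Fin 2 → A
pair a b zero       = a
pair a b (suc zero) = b

triple : {A : Set} → A → A → A → Fin 3 → A
triple a b c zero             = a
triple a b c (suc zero)       = b
triple a b c (suc (suc zero)) = c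

module Over (Th : Theory) where
  open Theory Th public

  T : Set → Set
  T = Term Op

  bind : {X Y : Set} → (X → T Y) → T X → T Y
  bind σ (var x)  = σ x
  bind σ (op o ts) = op o (λ i → bind σ (ts i))

  Tmap : {X Y : Set} → (X → Y) → T X → T Y
  Tmap f = bind (λ x → var (f x))

  Tjoin : {X : Set} → T (T X) → T X
  Tjoin = bind (λ t → t)

  -- Equational logic of the theory, over a relation R on the variables.
  -- T applied to a setoid (X , R) is (T X , Eqv R): terms modulo the
  -- equations of the theory.
  data Eqv {X : Set} (R : X → X → Set) : T X → T X → Set where
    var   : ∀ {x y} → R x y → Eqv R (var x) (var y)
    refl  : ∀ {t} → Eqv R t t
    sym   : ∀ {t u} → Eqv R t u → Eqv R u t
    trans : ∀ {t u v} → Eqv R t u → Eqv R u v → Eqv R t v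
    cong  : ∀ {n} (o : Op n) {ts us : Fin n → T X} →
            (∀ i → Eqv R (ts i) (us i)) → Eqv R (op o ts) (op o us)
    ax    : ∀ {n} (a : Ax n) (σ : Fin n → T X) →
            Eqv R (bind σ (lhs a)) (bind σ (rhs a))

  TS : Setoid 0ℓ 0ℓ → Setoid 0ℓ 0ℓ
  TS S = record
    { Carrier = T (Setoid.Carrier S)
    ; _≈_ = Eqv (Setoid._≈_ S)
    ; isEquivalence = record { refl = refl ; sym = sym ; trans = trans }
    }

  _≈ᵀ_ : {X : Set} → T X → T X → Set
  _≈ᵀ_ = Eqv _≡_

  Idempotent : T (Fin 2) → Set
  Idempotent s = bind (pair (var zero) (var zero)) s ≈ᵀ var {X = Fin 1} zero

  Commutative : T (Fin 2) → Set
  Commutative s = bind (pair (var (suc zero)) (var zero)) s ≈ᵀ s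

  Assoc : T (Fin 2) → Set
  Assoc s =
    bind (pair (bind (pair x₀ x₁) s) x₂) s ≈ᵀ bind (pair x₀ (bind (pair x₁ x₂) s)) s
    where
    x₀ x₁ x₂ : T (Fin 3)
    x₀ = var zero
    x₁ = var (suc zero)
    x₂ = var (suc (suc zero))

  opTerm : Op 2 → T (Fin 2)
  opTerm o = op o var

  evalWith : {A X : Set} → (∀ {n} → Op n → (Fin n → A) → A) → (X → A) → T X → A
  evalWith f ρ (var x)  = ρ x
  evalWith f ρ (op o ts) = f o (λ i → evalWith f ρ (ts i))

  record Model : Set₁ where
    field
      S      : Setoid 0ℓ 0ℓ
    open Setoid S public
    field
      ⟦_⟧    : ∀ {n} → Op n → (Fin n → Carrier) → Carrier
      ⟦⟧-cong : ∀ {n} (o : Op n) {xs ys : Fin n → Carrier} →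
               (∀ i → xs i ≈ ys i) → ⟦ o ⟧ xs ≈ ⟦ o ⟧ ys
      sound  : ∀ {n} (a : Ax n) (ρ : Fin n → Carrier) →
               evalWith ⟦_⟧ ρ (lhs a) ≈ evalWith ⟦_⟧ ρ (rhs a)

    α : T Carrier → Carrier
    α = evalWith ⟦_⟧ (λ x → x)

  record DistLaw : Set₁ where
    field
      ζ : (S : Setoid 0ℓ 0ℓ) → T (Delay (Setoid.Carrier S)) → Delay (T (Setoid.Carrier S))

      ζ-cong : (S : Setoid 0ℓ 0ℓ) {t u : T (Delay (Setoid.Carrier S))} →
               Setoid._≈_ (TS (DS S)) t u →
               Setoid._≈_ (DS (TS S)) (ζ S t) (ζ S u)

      ζ-nat : (S S′ : Setoid 0ℓ 0ℓ) (f : Func S S′) (t : T (Delay (Setoid.Carrier S))) →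
              Setoid._≈_ (DS (TS S′))
                (ζ S′ (Tmap (Dmap (Func.to f)) t))
                (Dmap (Tmap (Func.to f)) (ζ S t))

      ζ-unitᵀ : (S : Setoid 0ℓ 0ℓ) (d : Delay (Setoid.Carrier S)) →
                Setoid._≈_ (DS (TS S)) (ζ S (var d)) (Dmap var d)

      ζ-unitᴰ : (S : Setoid 0ℓ 0ℓ) (t : T (Setoid.Carrier S)) →
                Setoid._≈_ (DS (TS S)) (ζ S (Tmap now t)) (now t)

      ζ-multᵀ : (S : Setoid 0ℓ 0ℓ) (t : T (T (Delay (Setoid.Carrier S)))) →
                Setoid._≈_ (DS (TS S))
                  (ζ S (Tjoin t))
                  (Dmap Tjoin (ζ (TS S) (Tmap (ζ S) t)))

      ζ-multᴰ : (S : Setoid 0ℓ 0ℓ) (t : T (Delay (Delay (Setoid.Carrier S)))) →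
                Setoid._≈_ (DS (TS S))
                  (ζ S (Tmap Djoin t))
                  (Djoin (Dmap (ζ S) (ζ (DS S) t)))

  module Induced (L : DistLaw) (M : Model) where
    open DistLaw L
    open Model M

    αD : T (Delay Carrier) → Delay Carrier
    αD t = Dmap α (ζ S t)

    bin : T (Fin 2) → Delay Carrier → Delay Carrier → Delay Carrier
    bin s x y = αD (Tmap (pair x y) s)

    _≈D_ : Delay Carrier → Delay Carrier → Set
    _≈D_ = Bisim _≈_

-- ζ commutes with substituting delayed values for delayed variables (by ζ-multᴰ and
-- naturality) and with substituting terms (by ζ-multᵀ), so ⋄ on delayed arguments is
-- governed by what ζ does to ⋄ at generic delayed variables. At (step (now 0), step (now 1))
-- collapsing both variables to one and using idempotence of ⋄ shows that ζ takes exactly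
-- one step, to a term ⋄₁ which is itself idempotent; substituting ⋄ into ⋄ at such
-- variables transfers associativity and commutativity to ⋄₁. Delaying only the left
-- variable and then substituting (now 0, step (now 1)) recovers the one-step computation,
-- so these two stages take one and zero steps in some order; the intermediate term is ⋄′.

module Submission where

open import Defs
open import Data.Product using (Σ; ∃; _×_; _,_; proj₁; proj₂)
import Data.Product as Product
open import Data.Sum using (_⊎_; inj₁; inj₂)
import Data.Sum as Sum
open import Data.Nat using (zero; suc)
open import Data.Maybe using (Maybe; just; nothing)
import Data.Maybe as Maybe
open import Data.Maybe.Relation.Binary.Pointwise using (Pointwise; just; nothing)
import Data.Maybe.Relation.Binary.Pointwise as Pointwise
open import Level using (0ℓ)
open import Relation.Binary.Bundles using (Setoid)
open import Relation.Binary.PropositionalEquality as ≡ using (_≡_; _≗_; refl)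
open import Data.Fin using (Fin; zero; suc)
open import Function using (_∘_)
open import Function.Bundles using (Func)
import Relation.Binary.Reasoning.Setoid as SetoidReasoning

private variable
  A B C D : Set
  R R′ : A → B → Set
  a : A
  b : B
  d e d′ e′ : Delay A

next : Delay A → Delay A
next d n = d (suc n)

step∘now : A → Delay A
step∘now a = step (now a)

infixl 5 _>>=ᴰ_
_>>=ᴰ_ : Delay A → (A → Delay B) → Delay B
d >>=ᴰ f = Djoin (Dmap f d)

Pointwise-cases : {m : Maybe A} {m′ : Maybe B} → Pointwise R m m′ →
    (∃ λ a → ∃ λ a′ → m ≡ just a × m′ ≡ just a′ × R a a′)
  ⊎ (m ≡ nothing × m′ ≡ nothing)
Pointwise-cases (just r) = inj₁ (_ , _ , refl , refl , r)
Pointwise-cases nothing  = inj₂ (refl , refl)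

Pointwise-mono : (∀ {a b} → R a b → R′ a b) → {m : Maybe A} {m′ : Maybe B} →
  Pointwise R m m′ → Pointwise R′ m m′
Pointwise-mono f (just r) = just (f r)
Pointwise-mono f nothing  = nothing

Pointwise-map : {f : A → C} {g : B → D} → (∀ {a b} → R a b → R′ (f a) (g b)) →
  {m : Maybe A} {m′ : Maybe B} → Pointwise R m m′ → Pointwise R′ (Maybe.map f m) (Maybe.map g m′)
Pointwise-map h (just r) = just (h r)
Pointwise-map h nothing  = nothing

Pointwise-mapˡ⁻ : {f : A → C} {m : Maybe A} {m′ : Maybe B} →
  Pointwise R (Maybe.map f m) m′ → Pointwise (λ a b → R (f a) b) m m′
Pointwise-mapˡ⁻ {m = just _}  (just r) = just r
Pointwise-mapˡ⁻ {m = nothing} nothing  = nothing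

Pointwise-mapʳ⁻ : {g : B → C} {m : Maybe A} {m′ : Maybe B} →
  Pointwise R m (Maybe.map g m′) → Pointwise (λ a b → R a (g b)) m m′
Pointwise-mapʳ⁻ {m′ = just _}  (just r) = just r
Pointwise-mapʳ⁻ {m′ = nothing} nothing  = nothing

run-≗ : d ≗ e → ∀ n → run d n ≡ run e n
run-≗ {d = d} {e} eq zero = eq zero
run-≗ {d = d} {e} eq (suc n) with d zero | e zero | eq zero
... | just _  | just _  | refl = refl
... | nothing | nothing | refl = run-≗ (λ k → eq (suc k)) n

Bisim-resp : d ≗ d′ → e ≗ e′ → Bisim R d e → Bisim R d′ e′
Bisim-resp {R = R} p q r n = ≡.subst₂ (Pointwise R) (run-≗ p n) (run-≗ q n) (r n)

run-Dmap : (f : A → B) (d : Delay A) → ∀ n → run (Dmap f d) n ≡ Maybe.map f (run d n)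
run-Dmap f d zero = refl
run-Dmap f d (suc n) with d zero
... | just _  = refl
... | nothing = run-Dmap f (next d) n

Bisim-mono : (∀ {a b} → R a b → R′ a b) → Bisim R d e → Bisim R′ d e
Bisim-mono f p n = Pointwise-mono f (p n)

≗⇒≈ : (S : Setoid 0ℓ 0ℓ) {d e : Delay (Setoid.Carrier S)} → d ≗ e → Setoid._≈_ (DS S) d e
≗⇒≈ S {d} p = Bisim-resp (λ _ → refl) p (Setoid.refl (DS S) {d})

step-cong : Bisim R d e → Bisim R (step d) (step e)
step-cong p zero    = nothing
step-cong p (suc n) = p n

step-injective : Bisim R (step d) (step e) → Bisim R d e
step-injective p n = p (suc n)

now-cong : R a b → Bisim R (now a) (now b)
now-cong r zero    = just r
now-cong r (suc n) = nothing

now-injective : Bisim R (now a) (now b) → R a b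
now-injective p = Pointwise.drop-just (p zero)

step∘now-injective : Bisim R (step∘now a) (step∘now b) → R a b
step∘now-injective p = now-injective (step-injective p)

Dmap-cong : {f : A → C} {g : B → D} → (∀ {a b} → R a b → R′ (f a) (g b)) →
  Bisim R d e → Bisim R′ (Dmap f d) (Dmap g e)
Dmap-cong {R′ = R′} {d = d} {e} {f} {g} h p n =
  ≡.subst₂ (Pointwise R′) (≡.sym (run-Dmap f d n)) (≡.sym (run-Dmap g e n)) (Pointwise-map h (p n))

Bisim-Dmapˡ : {f : A → C} → Bisim R (Dmap f d) e → Bisim (λ a b → R (f a) b) d e
Bisim-Dmapˡ {R = R} {d = d} {e} {f} p n =
  Pointwise-mapˡ⁻ (≡.subst (λ m → Pointwise R m (run e n)) (run-Dmap f d n) (p n))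

Bisim-Dmapʳ : {g : B → C} → Bisim R d (Dmap g e) → Bisim (λ a b → R a (g b)) d e
Bisim-Dmapʳ {R = R} {d = d} {e} {g} p n =
  Pointwise-mapʳ⁻ (≡.subst (Pointwise R (run d n)) (run-Dmap g e n) (p n))

head-cases : (d : Delay A) → (∃ λ a → d zero ≡ just a) ⊎ d zero ≡ nothing
head-cases d with d zero
... | just a  = inj₁ (a , refl)
... | nothing = inj₂ refl

head-nothing : (d : Delay A) → d zero ≡ nothing → d ≗ step (next d)
head-nothing d eq zero    = eq
head-nothing d eq (suc n) = refl

head-just : (d : Delay A) → d zero ≡ just a → Bisim _≡_ d (now a)
head-just d eq zero    rewrite eq = just refl
head-just d eq (suc n) rewrite eq = nothing

≈now⇒ : Bisim R d (now b) → ∃ λ a → d zero ≡ just a × R a b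
≈now⇒ p with Pointwise-cases (p zero)
... | inj₁ (a , _ , eq , refl , r) = a , eq , r
... | inj₂ (_ , ())

≈step⇒ : Bisim R d (step e) → d zero ≡ nothing × Bisim R (next d) e
≈step⇒ {d = d} p with Pointwise-cases (p zero)
... | inj₁ (_ , _ , _ , () , _)
... | inj₂ (eq , _) = eq , step-injective (Bisim-resp (head-nothing d eq) (λ _ → refl) p)

≈step∘now⇒ : Bisim R d (step∘now b) → ∃ λ a → Bisim _≡_ d (step∘now a) × R a b
≈step∘now⇒ {d = d} p with ≈step⇒ p
... | eq , p′ with ≈now⇒ p′
... | a , eq′ , r =
  a , Bisim-resp (λ n → ≡.sym (head-nothing d eq n)) (λ _ → refl) (step-cong (head-just (next d) eq′)) ,
  r

now->>= : (f : A → Delay B) (a : A) → now a >>=ᴰ f ≗ f a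
now->>= f a n = refl

step∘now->>= : (f : A → Delay B) (a : A) → step∘now a >>=ᴰ f ≗ step (f a)
step∘now->>= f a zero    = refl
step∘now->>= f a (suc n) = refl

Dmap-step : (f : A → B) (d : Delay A) → Dmap f (step d) ≗ step (Dmap f d)
Dmap-step f d zero    = refl
Dmap-step f d (suc n) = refl

Dmap-step∘now : (f : A → B) → Dmap f (step∘now a) ≗ step∘now (f a)
Dmap-step∘now f = Dmap-step f (now _)

>>=-just : (d : Delay A) (f : A → Delay B) → d zero ≡ just a → d >>=ᴰ f ≗ f a
>>=-just d f eq n rewrite eq = refl

>>=-nothing : (d : Delay A) (f : A → Delay B) → d zero ≡ nothing → d >>=ᴰ f ≗ step (next d >>=ᴰ f)
>>=-nothing d f eq zero    rewrite eq = refl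
>>=-nothing d f eq (suc n) rewrite eq = refl

>>=-cong : {f : A → Delay C} {g : B → Delay D} → Bisim R d e →
  (∀ {a b} → R a b → Bisim R′ (f a) (g b)) → Bisim R′ (d >>=ᴰ f) (e >>=ᴰ g)
>>=-cong p fg n with Pointwise-cases (p zero)
>>=-cong {d = d} {e} {f = f} {g} p fg n | inj₁ (_ , _ , eq , eq′ , r) =
  Bisim-resp (λ k → ≡.sym (>>=-just d f eq k)) (λ k → ≡.sym (>>=-just e g eq′ k)) (fg r) n
>>=-cong {d = d} {e} {R′ = R′} {f = f} {g} p fg zero | inj₂ (eq , eq′) =
  ≡.subst₂ (Pointwise R′) (≡.sym (>>=-nothing d f eq zero)) (≡.sym (>>=-nothing e g eq′ zero)) nothing
>>=-cong {d = d} {e} {R′ = R′} {f = f} {g} p fg (suc n) | inj₂ (eq , eq′) =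
  ≡.subst₂ (Pointwise R′)
    (≡.sym (run-≗ (>>=-nothing d f eq) (suc n))) (≡.sym (run-≗ (>>=-nothing e g eq′) (suc n)))
    (>>=-cong (step-injective (Bisim-resp (head-nothing d eq) (head-nothing e eq′) p)) fg n)

>>=-≈now⇒ : {f : A → Delay B} → Bisim R (d >>=ᴰ f) (now b) →
  ∃ λ a → Bisim _≡_ d (now a) × Bisim R (f a) (now b)
>>=-≈now⇒ {d = d} {f = f} p with head-cases d
... | inj₁ (a , eq) = a , head-just d eq , Bisim-resp (>>=-just d f eq) (λ _ → refl) p
... | inj₂ eq with ≈now⇒ p
...   | _ , eq′ , _ with ≡.trans (≡.sym (>>=-nothing d f eq zero)) eq′
...     | ()

>>=-≈step∘now⇒ : {f : A → Delay B} → Bisim R (d >>=ᴰ f) (step∘now b) →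
  (∃ λ a → Bisim _≡_ d (now a) × Bisim R (f a) (step∘now b)) ⊎
  (∃ λ a → Bisim _≡_ d (step∘now a) × Bisim R (f a) (now b))
>>=-≈step∘now⇒ {d = d} {f = f} p with head-cases d
... | inj₁ (a , eq) = inj₁ (a , head-just d eq , Bisim-resp (>>=-just d f eq) (λ _ → refl) p)
... | inj₂ eq with >>=-≈now⇒ (step-injective (Bisim-resp (>>=-nothing d f eq) (λ _ → refl) p))
...   | a , p′ , r =
  inj₂ (a , Bisim-resp (λ n → ≡.sym (head-nothing d eq n)) (λ _ → refl) (step-cong p′) , r)

module TermProperties (Th : Theory) where
  open Over Th

  private variable
    X Y Z : Set
    Q : X → X → Set
    Rᵀ : Y → Y → Set
    t u : T X

  bind-bind : (σ : Y → T Z) (τ : X → T Y) (t : T X) →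
    Eqv Rᵀ (bind σ (bind τ t)) (bind (bind σ ∘ τ) t)
  bind-bind σ τ (var x)   = refl
  bind-bind σ τ (op o ts) = cong o (λ i → bind-bind σ τ (ts i))

  bind-congˡ : {σ τ : X → T Y} → (∀ x → Eqv Rᵀ (σ x) (τ x)) → (t : T X) →
    Eqv Rᵀ (bind σ t) (bind τ t)
  bind-congˡ h (var x)   = h x
  bind-congˡ h (op o ts) = cong o (λ i → bind-congˡ h (ts i))

  bind-congʳ : (σ : X → T Y) → (∀ {x y} → Q x y → Eqv Rᵀ (σ x) (σ y)) →
    Eqv Q t u → Eqv Rᵀ (bind σ t) (bind σ u)
  bind-congʳ σ h (var q)     = h q
  bind-congʳ σ h refl        = refl
  bind-congʳ σ h (sym p)     = sym (bind-congʳ σ h p)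
  bind-congʳ σ h (trans p q) = trans (bind-congʳ σ h p) (bind-congʳ σ h q)
  bind-congʳ σ h (cong o ps) = cong o (λ i → bind-congʳ σ h (ps i))
  bind-congʳ σ h (ax a τ)    =
    trans (bind-bind σ τ (lhs a)) (trans (ax a (bind σ ∘ τ)) (sym (bind-bind σ τ (rhs a))))

  Tmap-cong : (f : X → Y) → t ≈ᵀ u → Eqv Rᵀ (Tmap f t) (Tmap f u)
  Tmap-cong f = bind-congʳ (var ∘ f) (λ { refl → refl })

  Tjoin-cong : Eqv (Eqv Rᵀ) t u → Eqv Rᵀ (Tjoin t) (Tjoin u)
  Tjoin-cong = bind-congʳ (λ t → t) (λ p → p)

  Tjoin-Tmap : (σ : X → T Y) (t : T X) → Eqv Rᵀ (Tjoin (Tmap σ t)) (bind σ t)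
  Tjoin-Tmap σ t = bind-bind (λ t → t) (var ∘ σ) t

  module _ (M : Model) where
    open Model M

    eval-bind : (ρ : Y → Carrier) (σ : X → T Y) (t : T X) →
      evalWith ⟦_⟧ ρ (bind σ t) ≈ evalWith ⟦_⟧ (evalWith ⟦_⟧ ρ ∘ σ) t
    eval-bind ρ σ (var x)   = Setoid.refl S
    eval-bind ρ σ (op o ts) = ⟦⟧-cong o (λ i → eval-bind ρ σ (ts i))

    α-cong : {t u : T Carrier} → Eqv _≈_ t u → α t ≈ α u
    α-cong (var p)     = p
    α-cong refl        = Setoid.refl S
    α-cong (sym p)     = Setoid.sym S (α-cong p)
    α-cong (trans p q) = Setoid.trans S (α-cong p) (α-cong q)
    α-cong (cong o ps) = ⟦⟧-cong o (λ i → α-cong (ps i))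
    α-cong (ax a σ)    = Setoid.trans S (eval-bind (λ x → x) σ (lhs a))
      (Setoid.trans S (sound a (α ∘ σ)) (Setoid.sym S (eval-bind (λ x → x) σ (rhs a))))

module DistLawProperties (Th : Theory) (L : Over.DistLaw Th) where
  open Over Th
  open DistLaw L
  open TermProperties Th

  DTEq : (S : Setoid 0ℓ 0ℓ) (d e : Delay (T (Setoid.Carrier S))) → Set
  DTEq S = Setoid._≈_ (DS (TS S))
  syntax DTEq S d e = d ≈[ S ] e

  ζ-var-step∘now : (S : Setoid 0ℓ 0ℓ) (c : Setoid.Carrier S) →
    ζ S (var (step∘now c)) ≈[ S ] step∘now (var c)
  ζ-var-step∘now S c =
    Setoid.trans (DS (TS S)) (ζ-unitᵀ S (step∘now c)) (≗⇒≈ (TS S) (Dmap-step∘now var))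

  ζ-Tmap->>= : (S : Setoid 0ℓ 0ℓ) {V : Set} (g : V → Delay (Setoid.Carrier S))
    (w : T (Delay V)) →
    ζ S (Tmap (_>>=ᴰ g) w) ≈[ S ] (ζ (≡.setoid V) w >>=ᴰ ζ S ∘ Tmap g)
  ζ-Tmap->>= S {V} g w = begin
    ζ S (Tmap (_>>=ᴰ g) w)                ≈⟨ ζ-cong S (sym (bind-bind _ _ w)) ⟩
    ζ S (Tmap Djoin (Tmap (Dmap g) w))    ≈⟨ ζ-multᴰ S (Tmap (Dmap g) w) ⟩
    ζ (DS S) (Tmap (Dmap g) w) >>=ᴰ ζ S   ≈⟨ >>=-cong (Bisim-Dmapʳ {e = ζ V′ w} nat) (ζ-cong S) ⟩
    ζ V′ w >>=ᴰ ζ S ∘ Tmap g              ∎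
    where
    open SetoidReasoning (DS (TS S))
    V′ : Setoid 0ℓ 0ℓ
    V′ = ≡.setoid V
    g′ : Func V′ (DS S)
    g′ = record { to = g ; cong = λ { refl → Setoid.refl (DS S) } }
    nat : ζ (DS S) (Tmap (Dmap g) w) ≈[ DS S ] Dmap (Tmap g) (ζ V′ w)
    nat = ζ-nat V′ (DS S) g′ w

  ζ-Tmap-subst : (S : Setoid 0ℓ 0ℓ) {V U : Set} (s : T V) {δ : V → Delay U}
    {g : U → Delay (Setoid.Carrier S)} {h : V → Delay (Setoid.Carrier S)} →
    (∀ i → δ i >>=ᴰ g ≗ h i) →
    ζ S (Tmap h s) ≈[ S ] (ζ (≡.setoid U) (Tmap δ s) >>=ᴰ ζ S ∘ Tmap g)
  ζ-Tmap-subst S s {δ} {g} δ>>=g≗h = Setoid.trans (DS (TS S))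
    (ζ-cong S (trans (bind-congˡ (λ i → var (≗⇒≈ S (≡.sym ∘ δ>>=g≗h i))) s)
                     (sym (bind-bind _ _ s))))
    (ζ-Tmap->>= S g (Tmap δ s))

  ζ-bind-step∘now : {V W : Set} {s u : T V} {σ : V → T (Delay W)} {τ : V → T W} →
    ζ (≡.setoid V) (Tmap step∘now s) ≈[ ≡.setoid V ] step∘now u →
    (∀ i → ζ (≡.setoid W) (σ i) ≈[ ≡.setoid W ] step∘now (τ i)) →
    ζ (≡.setoid W) (bind σ s) ≈[ ≡.setoid W ] step∘now (bind τ u)
  ζ-bind-step∘now {V} {W} {s} {u} {σ} {τ} ζs≈ ζσ≈ = begin
    ζ W′ (bind σ s)                                  ≈⟨ ζ-cong W′ (sym (Tjoin-Tmap σ s)) ⟩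
    ζ W′ (Tjoin (Tmap σ s))                          ≈⟨ ζ-multᵀ W′ (Tmap σ s) ⟩
    Dmap Tjoin (ζ (TS W′) (Tmap (ζ W′) (Tmap σ s)))  ≈⟨ Dmap-cong Tjoin-cong inner ⟩
    Dmap Tjoin (step∘now (Tmap τ u))                 ≈⟨ ≗⇒≈ (TS W′) (Dmap-step∘now Tjoin) ⟩
    step∘now (Tjoin (Tmap τ u))                      ≈⟨ step-cong (now-cong (Tjoin-Tmap τ u)) ⟩
    step∘now (bind τ u)                              ∎
    where
    open SetoidReasoning (DS (TS (≡.setoid W)))
    V′ W′ : Setoid 0ℓ 0ℓ
    V′ = ≡.setoid V
    W′ = ≡.setoid W
    τ′ : Func V′ (TS W′)
    τ′ = record { to = τ ; cong = λ { refl → refl } }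
    leaf : ∀ i → ζ W′ (σ i) ≈[ W′ ] Dmap τ (step∘now i)
    leaf i = Setoid.trans (DS (TS W′)) (ζσ≈ i) (≗⇒≈ (TS W′) (≡.sym ∘ Dmap-step∘now τ))
    leaves : Setoid._≈_ (TS (DS (TS W′))) (Tmap (ζ W′) (Tmap σ s)) (Tmap (Dmap τ) (Tmap step∘now s))
    leaves = trans (bind-bind _ _ s) (trans (bind-congˡ (λ i → var (leaf i)) s) (sym (bind-bind _ _ s)))
    inner : ζ (TS W′) (Tmap (ζ W′) (Tmap σ s)) ≈[ TS W′ ] step∘now (Tmap τ u)
    inner = IR.begin
      ζ (TS W′) (Tmap (ζ W′) (Tmap σ s))
        IR.≈⟨ ζ-cong (TS W′) leaves ⟩
      ζ (TS W′) (Tmap (Dmap τ) (Tmap step∘now s))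
        IR.≈⟨ ζ-nat V′ (TS W′) τ′ (Tmap step∘now s) ⟩
      Dmap (Tmap τ) (ζ V′ (Tmap step∘now s))
        IR.≈⟨ Dmap-cong (Tmap-cong τ) ζs≈ ⟩
      Dmap (Tmap τ) (step∘now u)
        IR.≈⟨ ≗⇒≈ (TS (TS W′)) (Dmap-step∘now (Tmap τ)) ⟩
      step∘now (Tmap τ u)
        IR.∎
      where module IR = SetoidReasoning (DS (TS (TS W′)))

  module _ (M : Model) where
    open Model M using (S; α)
    open Induced L M using (αD; _≈D_)

    αD-Tmap-subst : {V U : Set} (s : T V) (δ : V → Delay U) {e : Delay (T U)}
      {g : U → Delay (Setoid.Carrier S)} {h : V → Delay (Setoid.Carrier S)} →
      ζ (≡.setoid U) (Tmap δ s) ≈[ ≡.setoid U ] e → (∀ i → δ i >>=ᴰ g ≗ h i) →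
      αD (Tmap h s) ≈D Dmap α (e >>=ᴰ ζ S ∘ Tmap g)
    αD-Tmap-subst s δ {g = g} ζ≈e δ>>=g≗h =
      Dmap-cong (α-cong M) (Setoid.trans (DS (TS S)) (ζ-Tmap-subst S s δ>>=g≗h)
        (>>=-cong ζ≈e (ζ-cong S ∘ Tmap-cong g)))

    αD-Tmap-now : {V U : Set} (s : T V) (δ : V → Delay U) {u : T U}
      {g : U → Delay (Setoid.Carrier S)} {h : V → Delay (Setoid.Carrier S)} →
      ζ (≡.setoid U) (Tmap δ s) ≈[ ≡.setoid U ] now u → (∀ i → δ i >>=ᴰ g ≗ h i) →
      αD (Tmap h s) ≈D αD (Tmap g u)
    αD-Tmap-now s δ {g = g} = αD-Tmap-subst s δ {g = g}

    αD-Tmap-step∘now : {V U : Set} (s : T V) (δ : V → Delay U) {u : T U}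
      {g : U → Delay (Setoid.Carrier S)} {h : V → Delay (Setoid.Carrier S)} →
      ζ (≡.setoid U) (Tmap δ s) ≈[ ≡.setoid U ] step∘now u → (∀ i → δ i >>=ᴰ g ≗ h i) →
      αD (Tmap h s) ≈D step (αD (Tmap g u))
    αD-Tmap-step∘now s δ {u} {g} ζ≈ δ>>=g≗h =
      Setoid.trans (DS S) (αD-Tmap-subst s δ {g = g} ζ≈ δ>>=g≗h) (≗⇒≈ S λ n →
        ≡.trans (≡.cong (Maybe.map α) (step∘now->>= (ζ S ∘ Tmap g) u n))
                (Dmap-step α (ζ S (Tmap g u)) n))

  ζ-pair-vars : {W : Set} {a b : W} (i : Fin 2) →
    ζ (≡.setoid W) (Tmap step∘now (pair (var a) (var b) i))
      ≈[ ≡.setoid W ] step∘now (pair (var a) (var b) i)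
  ζ-pair-vars zero       = ζ-var-step∘now _ _
  ζ-pair-vars (suc zero) = ζ-var-step∘now _ _

  stepˡ stepʳ : Fin 2 → Delay (Fin 2)
  stepˡ = pair (step∘now zero) (now (suc zero))
  stepʳ = pair (now zero) (step∘now (suc zero))

  F₂ : Setoid 0ℓ 0ℓ
  F₂ = ≡.setoid (Fin 2)

  module _ (s u : T (Fin 2)) where
    bin-step-step : ζ F₂ (Tmap step∘now s) ≈[ F₂ ] step∘now u →
      ∀ (M : Model) → let open Induced L M in
      ∀ x y → bin s (step x) (step y) ≈D step (bin u x y)
    bin-step-step ζ≈ M x y = αD-Tmap-step∘now M s step∘now ζ≈ λ where
      zero       → step∘now->>= (pair x y) zero
      (suc zero) → step∘now->>= (pair x y) (suc zero)

    bin-stepˡ-delayed : ζ F₂ (Tmap stepˡ s) ≈[ F₂ ] step∘now u →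
      ∀ (M : Model) → let open Induced L M in
      ∀ x y → bin s (step x) y ≈D step (bin u x y)
    bin-stepˡ-delayed ζ≈ M x y = αD-Tmap-step∘now M s stepˡ ζ≈ λ where
      zero       → step∘now->>= (pair x y) zero
      (suc zero) → now->>= (pair x y) (suc zero)

    bin-stepˡ-immediate : ζ F₂ (Tmap stepˡ s) ≈[ F₂ ] now u →
      ∀ (M : Model) → let open Induced L M in
      ∀ x y → bin s (step x) y ≈D bin u x y
    bin-stepˡ-immediate ζ≈ M x y = αD-Tmap-now M s stepˡ ζ≈ λ where
      zero       → step∘now->>= (pair x y) zero
      (suc zero) → now->>= (pair x y) (suc zero)

    bin-stepʳ-delayed : ζ F₂ (Tmap stepʳ s) ≈[ F₂ ] step∘now u →
      ∀ (M : Model) → let open Induced L M in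
      ∀ x y → bin s x (step y) ≈D step (bin u x y)
    bin-stepʳ-delayed ζ≈ M x y = αD-Tmap-step∘now M s stepʳ ζ≈ λ where
      zero       → now->>= (pair x y) zero
      (suc zero) → step∘now->>= (pair x y) (suc zero)

    bin-stepʳ-immediate : ζ F₂ (Tmap stepʳ s) ≈[ F₂ ] now u →
      ∀ (M : Model) → let open Induced L M in
      ∀ x y → bin s x (step y) ≈D bin u x y
    bin-stepʳ-immediate ζ≈ M x y = αD-Tmap-now M s stepʳ ζ≈ λ where
      zero       → now->>= (pair x y) zero
      (suc zero) → step∘now->>= (pair x y) (suc zero)

module Lemma6p1 (Th : Theory) (⋄ : Over.Op Th 2) (idem : Over.Idempotent Th (Over.opTerm Th ⋄))
                (L : Over.DistLaw Th) where
  open Over Th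
  open DistLaw L
  open TermProperties Th
  open DistLawProperties Th L

  F₁ F₃ : Setoid 0ℓ 0ℓ
  F₁ = ≡.setoid (Fin 1)
  F₃ = ≡.setoid (Fin 3)

  collapse : Func F₂ F₁
  collapse = record { to = λ _ → zero ; cong = λ _ → refl }

  ζ-⋄-step∘now-collapsed :
    Dmap (Tmap (Func.to collapse)) (ζ F₂ (Tmap step∘now (opTerm ⋄))) ≈[ F₁ ] step∘now (var zero)
  ζ-⋄-step∘now-collapsed = begin
    Dmap (Tmap (Func.to collapse)) (ζ F₂ w)  ≈⟨ ζ-nat F₂ F₁ collapse w ⟨
    ζ F₁ (Tmap (Dmap (Func.to collapse)) w)  ≈⟨ ζ-cong F₁ ⋄-collapsed ⟩
    ζ F₁ (var (step∘now zero))               ≈⟨ ζ-var-step∘now F₁ zero ⟩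
    step∘now (var zero)                      ∎
    where
    open SetoidReasoning (DS (TS F₁))
    w : T (Delay (Fin 2))
    w = Tmap step∘now (opTerm ⋄)
    c≈ : {i : Fin 2} → Setoid._≈_ (DS F₁) (Dmap (Func.to collapse) (step∘now i)) (step∘now zero)
    c≈ = ≗⇒≈ F₁ (Dmap-step∘now _)
    ⋄-collapsed : Setoid._≈_ (TS (DS F₁)) (Tmap (Dmap (Func.to collapse)) w) (var (step∘now zero))
    ⋄-collapsed =
      trans (cong ⋄ λ { zero → var c≈ ; (suc zero) → var c≈ })
            (Tmap-cong (λ _ → step∘now zero) idem)

  ζ-⋄-one-step : Σ (T (Fin 2)) λ u →
    ζ F₂ (Tmap step∘now (opTerm ⋄)) ≈[ F₂ ] step∘now u × Idempotent u
  ζ-⋄-one-step with ≈step∘now⇒ (Bisim-Dmapˡ ζ-⋄-step∘now-collapsed)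
  ... | u , ζ≡ , u-collapses =
    u , Bisim-mono (λ { refl → refl }) ζ≡ ,
    trans (bind-congˡ (λ { zero → refl ; (suc zero) → refl }) u) u-collapses

  ⋄₁ : T (Fin 2)
  ⋄₁ = proj₁ ζ-⋄-one-step

  ζ-⋄ : ζ F₂ (Tmap step∘now (opTerm ⋄)) ≈[ F₂ ] step∘now ⋄₁
  ζ-⋄ = proj₁ (proj₂ ζ-⋄-one-step)

  ⋄₁-idempotent : Idempotent ⋄₁
  ⋄₁-idempotent = proj₂ (proj₂ ζ-⋄-one-step)

  ζ-⋄-bind : {W : Set} {σ : Fin 2 → T (Delay W)} {τ : Fin 2 → T W} →
    (∀ i → ζ (≡.setoid W) (σ i) ≈[ ≡.setoid W ] step∘now (τ i)) →
    ζ (≡.setoid W) (op ⋄ σ) ≈[ ≡.setoid W ] step∘now (bind τ ⋄₁)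
  ζ-⋄-bind = ζ-bind-step∘now {s = opTerm ⋄} ζ-⋄

  ⋄₁-commutative : Commutative (opTerm ⋄) → Commutative ⋄₁
  ⋄₁-commutative comm = step∘now-injective (begin
    step∘now (bind swap ⋄₁)                         ≈⟨ ζ-⋄-bind ζ-pair-vars ⟨
    ζ F₂ (Tmap step∘now (bind swap (opTerm ⋄)))     ≈⟨ ζ-cong F₂ (Tmap-cong step∘now comm) ⟩
    ζ F₂ (Tmap step∘now (opTerm ⋄))                 ≈⟨ ζ-⋄ ⟩
    step∘now ⋄₁                                     ∎)
    where
    open SetoidReasoning (DS (TS F₂))
    swap : Fin 2 → T (Fin 2)
    swap = pair (var (suc zero)) (var zero)

  ⋄₁-associative : Assoc (opTerm ⋄) → Assoc ⋄₁
  ⋄₁-associative assoc = step∘now-injective (begin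
    step∘now ((x₀ ⋄₁⟨ x₁ ⟩) ⋄₁⟨ x₂ ⟩)
      ≈⟨ ζ-⋄-bind (λ { zero → ζ-⋄-bind ζ-pair-vars ; (suc zero) → ζ-var-step∘now _ _ }) ⟨
    ζ F₃ (Tmap step∘now ((x₀ ⋄⟨ x₁ ⟩) ⋄⟨ x₂ ⟩))
      ≈⟨ ζ-cong F₃ (Tmap-cong step∘now assoc) ⟩
    ζ F₃ (Tmap step∘now (x₀ ⋄⟨ x₁ ⋄⟨ x₂ ⟩ ⟩))
      ≈⟨ ζ-⋄-bind (λ { zero → ζ-var-step∘now _ _ ; (suc zero) → ζ-⋄-bind ζ-pair-vars }) ⟩
    step∘now (x₀ ⋄₁⟨ x₁ ⋄₁⟨ x₂ ⟩ ⟩)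
      ∎)
    where
    open SetoidReasoning (DS (TS F₃))
    x₀ x₁ x₂ : T (Fin 3)
    x₀ = var zero
    x₁ = var (suc zero)
    x₂ = var (suc (suc zero))
    _⋄⟨_⟩ _⋄₁⟨_⟩ : T (Fin 3) → T (Fin 3) → T (Fin 3)
    a ⋄⟨ b ⟩ = bind (pair a b) (opTerm ⋄)
    a ⋄₁⟨ b ⟩ = bind (pair a b) ⋄₁

  ζ-⋄-stepˡ-cases : Σ (T (Fin 2)) λ ⋄′ →
      (ζ F₂ (Tmap stepˡ (opTerm ⋄)) ≈[ F₂ ] step∘now ⋄′
        × ζ F₂ (Tmap stepʳ ⋄′) ≈[ F₂ ] now ⋄₁)
    ⊎ (ζ F₂ (Tmap stepˡ (opTerm ⋄)) ≈[ F₂ ] now ⋄′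
        × ζ F₂ (Tmap stepʳ ⋄′) ≈[ F₂ ] step∘now ⋄₁)
  ζ-⋄-stepˡ-cases with >>=-≈step∘now⇒ (Setoid.trans (DS (TS F₂)) (Setoid.sym (DS (TS F₂)) split) ζ-⋄)
    where
    split : ζ F₂ (Tmap step∘now (opTerm ⋄))
      ≈[ F₂ ] (ζ F₂ (Tmap stepˡ (opTerm ⋄)) >>=ᴰ ζ F₂ ∘ Tmap stepʳ)
    split = ζ-Tmap-subst F₂ (opTerm ⋄) λ where
      zero       → step∘now->>= stepʳ zero
      (suc zero) → now->>= stepʳ (suc zero)
  ... | inj₁ (u , ζ≡ , r) = u , inj₂ (Bisim-mono (λ { refl → refl }) ζ≡ , r)
  ... | inj₂ (u , ζ≡ , r) = u , inj₁ (Bisim-mono (λ { refl → refl }) ζ≡ , r)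

  ⋄′ : T (Fin 2)
  ⋄′ = proj₁ ζ-⋄-stepˡ-cases


lemma6p1 : (Th : Theory) → let open Over Th in
    (⋄ : Op 2) → Idempotent (opTerm ⋄) → (L : DistLaw) →
    Σ (T (Fin 2)) λ ⋄₁ → Σ (T (Fin 2)) λ ⋄′ →
      (∀ (M : Model) → let open Induced L M in
        ∀ x y → bin (opTerm ⋄) (step x) (step y) ≈D step (bin ⋄₁ x y))
      × (((∀ (M : Model) → let open Induced L M in
             ∀ x y → bin (opTerm ⋄) (step x) y ≈D step (bin ⋄′ x y))
          × (∀ (M : Model) → let open Induced L M in
             ∀ x y → bin ⋄′ x (step y) ≈D bin ⋄₁ x y))
         ⊎ ((∀ (M : Model) → let open Induced L M in
             ∀ x y → bin (opTerm ⋄) (step x) y ≈D bin ⋄′ x y)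
          × (∀ (M : Model) → let open Induced L M in
             ∀ x y → bin ⋄′ x (step y) ≈D step (bin ⋄₁ x y))))
      × Idempotent ⋄₁
      × (Assoc (opTerm ⋄) → Assoc ⋄₁)
      × (Commutative (opTerm ⋄) → Commutative ⋄₁)
lemma6p1 Th ⋄ idem L =
  ⋄₁ , ⋄′ , bin-step-step (opTerm ⋄) ⋄₁ ζ-⋄ ,
  Sum.map (Product.map (bin-stepˡ-delayed (opTerm ⋄) ⋄′) (bin-stepʳ-immediate ⋄′ ⋄₁))
          (Product.map (bin-stepˡ-immediate (opTerm ⋄) ⋄′) (bin-stepʳ-delayed ⋄′ ⋄₁))
          (proj₂ ζ-⋄-stepˡ-cases) ,
  ⋄₁-idempotent , ⋄₁-associative , ⋄₁-commutative
  where
  open Over Th using (opTerm)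
  open DistLawProperties Th L
  open Lemma6p1 Th ⋄ idem L
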